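{- Let $n,p,k$ be integers with $0\leq p\leq \binom{n}{2}/2$ and $k=\binom{n}{2}-2p$. Then $f(n,k)\leq \binom{n}{2}-p$.
   Context: All graphs are finite, simple and undirected. For a connected graph $G$, an edge-coloring of $G$ (adjacent edges may receive the same color) is a monochromatic connection coloring (MC-coloring) if any two vertices of $G$ are joined by a path all of whose edges have the same color. The monochromatic connection number $mc(G)$ is the maximum number of colors used in an MC-coloring of $G$. For positive integers $n,k$ with $1\leq k\leq\binom{n}{2}$, $f(n,k)$ is the minimum integer such that every connected graph $G$ on $n$ vertices with $|E(G)|\geq f(n,k)$ satisfies $mc(G)\geq k$. -}

module Defs where

open import Data.Nat using (ℕ; zero; suc; _+_; _∸_; _≤_; _<?_; _≟_)
open import Data.Nat.Combinatorics using (_C_)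
open import Data.Fin using (Fin; toℕ)
open import Data.Bool using (Bool; true; false; T)
open import Data.Bool.Properties using (T?)
open import Data.List using (List; []; _∷_; length; filter; map; cartesianProduct; allFin; deduplicate)
open import Data.List.Relation.Unary.Unique.Propositional using (Unique)
open import Data.Product using (Σ; _×_; _,_; ∃; ∃-syntax; proj₁; proj₂)
open import Data.Unit using (⊤)
open import Relation.Nullary.Decidable using (_×-dec_)
open import Relation.Binary.PropositionalEquality using (_≡_)

record Graph (n : ℕ) : Set where
  field
    adj    : Fin n → Fin n → Bool
    sym    : ∀ i j → adj i j ≡ adj j i
    irrefl : ∀ i → adj i i ≡ false
open Graph public

-- The edge set: unordered pairs {i,j} represented as (i , j) with i < j.
edges : ∀ {n} → Graph n → List (Fin n × Fin n)
edges {n} G = filter (λ p → (toℕ (proj₁ p) <? toℕ (proj₂ p)) ×-dec T? (adj G (proj₁ p) (proj₂ p)))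
                     (cartesianProduct (allFin n) (allFin n))

numEdges : ∀ {n} → Graph n → ℕ
numEdges G = length (edges G)

data Walk {n} (G : Graph n) (P : Fin n → Fin n → Set) : Fin n → Fin n → Set where
  here : ∀ u → Walk G P u u
  step : ∀ {u w v} → adj G u w ≡ true → P u w → Walk G P w v → Walk G P u v

walkVertices : ∀ {n} {G : Graph n} {P} {u v} → Walk G P u v → List (Fin n)
walkVertices (here u) = u ∷ []
walkVertices (step {u = u} _ _ w) = u ∷ walkVertices w

Path : ∀ {n} (G : Graph n) (P : Fin n → Fin n → Set) → Fin n → Fin n → Set
Path G P u v = Σ (Walk G P u v) (λ w → Unique (walkVertices w))

Connected : ∀ {n} → Graph n → Set
Connected {n} G = ∀ (u v : Fin n) → Path G (λ _ _ → ⊤) u v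

-- An edge-coloring: a color (natural number) for each edge, symmetric in the endpoints
-- (adjacent edges may receive the same color).
record EdgeColoring {n} (G : Graph n) : Set where
  field
    col    : Fin n → Fin n → ℕ
    colSym : ∀ i j → adj G i j ≡ true → col i j ≡ col j i
open EdgeColoring public

numColors : ∀ {n} {G : Graph n} → EdgeColoring G → ℕ
numColors {G = G} c = length (deduplicate _≟_ (map (λ p → col c (proj₁ p) (proj₂ p)) (edges G)))

IsMC : ∀ {n} {G : Graph n} → EdgeColoring G → Set
IsMC {n} {G} c = ∀ (u v : Fin n) → ∃[ a ] Path G (λ i j → col c i j ≡ a) u v

-- mc(G) ≥ k  (mc(G) is the maximum number of colors in an MC-coloring).
mc≥ : ∀ {n} → Graph n → ℕ → Set
mc≥ G k = Σ (EdgeColoring G) (λ c → IsMC c × k ≤ numColors c)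

FProp : ℕ → ℕ → ℕ → Set
FProp n k m = ∀ (G : Graph n) → Connected G → m ≤ numEdges G → mc≥ G k

-- f(n,k) ≤ m : the minimum m' with FProp n k m' is at most m,
-- i.e. some m' ≤ m has the property.
f≤ : ℕ → ℕ → ℕ → Set
f≤ n k m = ∃[ m' ] (m' ≤ m × FProp n k m')

-- Let H be the complement of G. We give G an MC-coloring in which every edge keeps its own color, distinct
-- for distinct edges, except for at most n − c(H) ≤ |E(H)| edges, where c(H) is the number of components of
-- H; so mc(G) ≥ |E(G)| − |E(H)| ≥ C(n,2) − 2p once |E(G)| ≥ C(n,2) − p. If H is connected, a spanning tree
-- of G gets a single color. Otherwise fix roots a ≠ b of two components of H and join each vertex x to its
-- hub (b if x lies in the component of a, else a) by an edge of G whose color depends only on the component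
-- of x: two vertices that are not adjacent in G lie in one component of H and meet at their common hub.
-- In both cases the recolored edges are matched with the non-root vertices of a spanning forest.

module Submission where

open import Defs hiding (sym)
open import Data.Bool using (Bool; true; false; not; T; if_then_else_)
open import Data.Bool.Properties using (T?; T-≡)
open import Data.Empty using (⊥; ⊥-elim)
open import Data.Fin using (Fin; zero; toℕ; combine)
open import Data.Fin.Properties using (_≟_; toℕ-injective; combine-injective; all?; ¬∀⟶∃¬)
open import Data.List using (List; []; _∷_; length; filter; map; _++_; cartesianProduct; allFin; deduplicate)
open import Data.List.Properties using (length-++; length-map; length-tabulate; filter-++; filter-notAll)
open import Data.List.Relation.Unary.All using (All; []; _∷_)
import Data.List.Relation.Unary.All as All
open import Data.List.Relation.Unary.All.Properties using (¬Any⇒All¬)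
import Data.List.Relation.Unary.All.Properties as All
open import Data.List.Relation.Unary.Any using (Any; here; there)
import Data.List.Relation.Unary.Any as Any
open import Data.List.Relation.Unary.AllPairs using ([]; _∷_)
open import Data.List.Relation.Unary.Unique.Propositional using (Unique)
open import Data.List.Relation.Unary.Unique.Propositional.Properties using (allFin⁺; filter⁺; cartesianProduct⁺)
open import Data.List.Relation.Binary.Subset.Propositional using (_⊆_)
open import Data.List.Membership.Propositional using (_∈_)
open import Data.List.Membership.Propositional.Properties
  using (∈-allFin; ∈-filter⁺; ∈-filter⁻; ∈-cartesianProduct⁺; ∈-map⁺; ∈-map⁻; ∈-deduplicate⁺)
import Data.List.Membership.DecPropositional as DecMembership
open import Data.Nat using (ℕ; zero; suc; _+_; _*_; _∸_; _≤_; _<_; z≤n; s≤s; s≤s⁻¹; _<?_; _⊓_)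
import Data.Nat as ℕ
open import Data.Nat.Combinatorics using (_C_; nCk+nC[k+1]≡[n+1]C[k+1]; nC1≡n)
open import Data.Nat.ListAction using (sum)
open import Data.Nat.Properties hiding (_≟_)
open import Algebra.Properties.CommutativeSemigroup +-commutativeSemigroup using (x∙yz≈y∙xz; interchange)
open import Data.Product using (Σ-syntax; ∃-syntax; _×_; _,_; proj₁; proj₂; swap)
open import Data.Product.Properties using (×-≡,≡←≡; ×-≡,≡→≡; ≡-dec)
open import Data.Sum using (_⊎_; inj₁; inj₂)
import Data.Sum as Sum
open import Function using (id; _∘_; Equivalence)
open import Relation.Nullary using (¬_; Dec; yes; no; does; ¬?)
open import Relation.Nullary.Decidable using (_×-dec_; _⊎-dec_)
open import Relation.Nullary.Negation using (contradiction)
open import Relation.Unary using (Decidable)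
open import Relation.Binary.Definitions using (DecidableEquality; tri<; tri≈; tri>)
open import Relation.Binary.PropositionalEquality
  using (module ≡-Reasoning; _≡_; _≢_; refl; sym; trans; cong; cong₂; subst; ≢-sym)

module _ {A : Set} (_≟_ : DecidableEquality A) where

  Unique-⊆⇒length≤ : ∀ {xs ys : List A} → Unique xs → xs ⊆ ys → length xs ≤ length ys
  Unique-⊆⇒length≤ {[]} _ _ = z≤n
  Unique-⊆⇒length≤ {x ∷ xs} {ys} (x∉xs ∷ xs!) xs⊆ys = begin-strict
    length xs                     ≤⟨ Unique-⊆⇒length≤ xs! xs⊆ys-x ⟩
    length (filter (x ≢?_) ys)    <⟨ filter-notAll (x ≢?_) ys x∈ys ⟩
    length ys                     ∎
    where
    open ≤-Reasoning
    _≢?_ : ∀ x → Decidable (x ≢_)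
    x ≢? y = ¬? (x ≟ y)
    x∈ys : Any (λ y → ¬ x ≢ y) ys
    x∈ys = Any.map (λ x≡y x≢y → x≢y x≡y) (xs⊆ys (here refl))
    xs⊆ys-x : xs ⊆ filter (x ≢?_) ys
    xs⊆ys-x z∈xs = ∈-filter⁺ (x ≢?_) (xs⊆ys (there z∈xs)) (All.lookup x∉xs z∈xs)

map⁺-injectiveOn : ∀ {A B : Set} (f : A → B) {xs : List A} → Unique xs →
                   (∀ {x y} → x ∈ xs → y ∈ xs → f x ≡ f y → x ≡ y) → Unique (map f xs)
map⁺-injectiveOn f {[]} [] _ = []
map⁺-injectiveOn f {x ∷ xs} (x∉xs ∷ xs!) f-inj =
  All.map⁺ (All.tabulate (λ y∈xs fx≡fy → All.lookup x∉xs y∈xs (f-inj (here refl) (there y∈xs) fx≡fy)))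
  ∷ map⁺-injectiveOn f xs! (λ x∈xs y∈xs → f-inj (there x∈xs) (there y∈xs))

module _ {A B : Set} (_≟_ : DecidableEquality B) where

  length-≤-injectiveOn : ∀ (f : A → B) {xs : List A} {ys : List B} → Unique xs →
                         (∀ {x} → x ∈ xs → f x ∈ ys) →
                         (∀ {x y} → x ∈ xs → y ∈ xs → f x ≡ f y → x ≡ y) →
                         length xs ≤ length ys
  length-≤-injectiveOn f {xs} {ys} xs! f[xs]⊆ys f-inj = begin
    length xs          ≡⟨ length-map f xs ⟨
    length (map f xs)  ≤⟨ Unique-⊆⇒length≤ _≟_ (map⁺-injectiveOn f xs! f-inj) map-f-xs⊆ys ⟩
    length ys          ∎
    where
    open ≤-Reasoning
    map-f-xs⊆ys : map f xs ⊆ ys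
    map-f-xs⊆ys fx∈ with ∈-map⁻ f fx∈
    ... | x , x∈xs , refl = f[xs]⊆ys x∈xs

  length-≤-cover : ∀ (f : A → B) {xs : List A} {ys : List B} → Unique ys →
                   (∀ {y} → y ∈ ys → ∃[ x ] (x ∈ xs × y ≡ f x)) → length ys ≤ length xs
  length-≤-cover f {xs} {ys} ys! covered = begin
    length ys          ≤⟨ Unique-⊆⇒length≤ _≟_ ys! ys⊆f[xs] ⟩
    length (map f xs)  ≡⟨ length-map f xs ⟩
    length xs          ∎
    where
    open ≤-Reasoning
    ys⊆f[xs] : ys ⊆ map f xs
    ys⊆f[xs] y∈ys with covered y∈ys
    ... | x , x∈xs , refl = ∈-map⁺ f x∈xs

indicator : ∀ {P : Set} → Dec P → ℕ
indicator P? = if does P? then 1 else 0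

indicator-yes : ∀ {P : Set} (P? : Dec P) → P → indicator P? ≡ 1
indicator-yes (yes _) _ = refl
indicator-yes (no ¬p) p = contradiction p ¬p

indicator-no : ∀ {P : Set} (P? : Dec P) → ¬ P → indicator P? ≡ 0
indicator-no (yes p) ¬p = contradiction p ¬p
indicator-no (no _) _ = refl

module _ {A : Set} {P : A → Set} (P? : Decidable P) where

  count : List A → ℕ
  count xs = length (filter P? xs)

  count-∷ : ∀ x xs → count (x ∷ xs) ≡ indicator (P? x) + count xs
  count-∷ x xs with does (P? x)
  ... | true  = refl
  ... | false = refl

  count-++ : ∀ xs ys → count (xs ++ ys) ≡ count xs + count ys
  count-++ xs ys = trans (cong length (filter-++ P? xs ys)) (length-++ (filter P? xs))

  count+count-∁≡length : ∀ xs → count xs + length (filter (¬? ∘ P?) xs) ≡ length xs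
  count+count-∁≡length [] = refl
  count+count-∁≡length (x ∷ xs) with P? x
  ... | yes _ = cong suc (count+count-∁≡length xs)
  ... | no  _ = trans (+-suc _ _) (cong suc (count+count-∁≡length xs))

  module _ {Q Q′ : A → Set} (Q? : Decidable Q) (Q′? : Decidable Q′)
           (Q′⇒¬Q : ∀ {x} → Q′ x → ¬ Q x) (¬Q⇒Q′ : ∀ {x} → P x → ¬ Q x → Q′ x) where

    count-split : ∀ xs → length (filter (λ x → P? x ×-dec Q? x) xs) +
                         length (filter (λ x → P? x ×-dec Q′? x) xs) ≡ count xs
    count-split [] = refl
    count-split (x ∷ xs) with P? x | Q? x | Q′? x
    ... | yes _  | yes q  | yes q′ = contradiction q (Q′⇒¬Q q′)
    ... | yes _  | yes _  | no  _  = cong suc (count-split xs)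
    ... | yes _  | no  _  | yes _  = trans (+-suc _ _) (cong suc (count-split xs))
    ... | yes p  | no  ¬q | no ¬q′ = contradiction (¬Q⇒Q′ p ¬q) ¬q′
    ... | no  _  | _      | _      = count-split xs

module _ {A : Set} {P : A × A → Set} (P? : Decidable P) where

  count-cartesianProduct-∷ʳ : ∀ xs y ys → count P? (cartesianProduct xs (y ∷ ys)) ≡
                              count P? (map (_, y) xs) + count P? (cartesianProduct xs ys)
  count-cartesianProduct-∷ʳ [] y ys = refl
  count-cartesianProduct-∷ʳ (x ∷ xs) y ys = begin
    count P? ((x , y) ∷ map (x ,_) ys ++ cartesianProduct xs (y ∷ ys))
      ≡⟨ count-∷ P? (x , y) _ ⟩
    [x,y] + count P? (map (x ,_) ys ++ cartesianProduct xs (y ∷ ys))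
      ≡⟨ cong ([x,y] +_) (count-++ P? (map (x ,_) ys) _) ⟩
    [x,y] + (count P? (map (x ,_) ys) + count P? (cartesianProduct xs (y ∷ ys)))
      ≡⟨ cong (λ t → [x,y] + (count P? (map (x ,_) ys) + t)) (count-cartesianProduct-∷ʳ xs y ys) ⟩
    [x,y] + (count P? (map (x ,_) ys) + (count P? (map (_, y) xs) + count P? (cartesianProduct xs ys)))
      ≡⟨ cong ([x,y] +_) (x∙yz≈y∙xz (count P? (map (x ,_) ys)) (count P? (map (_, y) xs))
                                      (count P? (cartesianProduct xs ys))) ⟩
    [x,y] + (count P? (map (_, y) xs) + (count P? (map (x ,_) ys) + count P? (cartesianProduct xs ys)))
      ≡⟨ +-assoc [x,y] _ _ ⟨
    ([x,y] + count P? (map (_, y) xs)) + (count P? (map (x ,_) ys) + count P? (cartesianProduct xs ys))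
      ≡⟨ cong₂ _+_ (count-∷ P? (x , y) _) (count-++ P? (map (x ,_) ys) _) ⟨
    count P? (map (_, y) (x ∷ xs)) + count P? (cartesianProduct (x ∷ xs) ys) ∎
    where
    open ≡-Reasoning
    [x,y] : ℕ
    [x,y] = indicator (P? (x , y))

module _ {n : ℕ} where

  ordered? : Decidable {A = Fin n × Fin n} (λ p → toℕ (proj₁ p) < toℕ (proj₂ p))
  ordered? p = toℕ (proj₁ p) <? toℕ (proj₂ p)

  count-ordered-row+column : ∀ z L → All (z ≢_) L →
                             count ordered? (map (z ,_) L) + count ordered? (map (_, z) L) ≡ length L
  count-ordered-row+column z [] [] = refl
  count-ordered-row+column z (y ∷ L) (z≢y ∷ z∉L) = begin
    count ordered? ((z , y) ∷ map (z ,_) L) + count ordered? ((y , z) ∷ map (_, z) L)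
      ≡⟨ cong₂ _+_ (count-∷ ordered? (z , y) _) (count-∷ ordered? (y , z) _) ⟩
    ([z<y] + count ordered? (map (z ,_) L)) + ([y<z] + count ordered? (map (_, z) L))
      ≡⟨ interchange [z<y] _ [y<z] _ ⟩
    ([z<y] + [y<z]) + (count ordered? (map (z ,_) L) + count ordered? (map (_, z) L))
      ≡⟨ cong₂ _+_ exactly-one (count-ordered-row+column z L z∉L) ⟩
    suc (length L) ∎
    where
    open ≡-Reasoning
    [z<y] [y<z] : ℕ
    [z<y] = indicator (toℕ z <? toℕ y)
    [y<z] = indicator (toℕ y <? toℕ z)
    exactly-one : indicator (toℕ z <? toℕ y) + indicator (toℕ y <? toℕ z) ≡ 1
    exactly-one with <-cmp (toℕ z) (toℕ y)
    ... | tri< z<y _ y≮z = cong₂ _+_ (indicator-yes (toℕ z <? toℕ y) z<y) (indicator-no (toℕ y <? toℕ z) y≮z)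
    ... | tri≈ _ z≡y _   = contradiction (toℕ-injective z≡y) z≢y
    ... | tri> z≮y _ y<z = cong₂ _+_ (indicator-no (toℕ z <? toℕ y) z≮y) (indicator-yes (toℕ y <? toℕ z) y<z)

  count-ordered-pairs : ∀ (L : List (Fin n)) → Unique L → count ordered? (cartesianProduct L L) ≡ length L C 2
  count-ordered-pairs [] _ = refl
  count-ordered-pairs (z ∷ L) (z∉L ∷ L!) = begin
    count ordered? ((z , z) ∷ map (z ,_) L ++ cartesianProduct L (z ∷ L))
      ≡⟨ count-∷ ordered? (z , z) _ ⟩
    [z<z] + count ordered? (map (z ,_) L ++ cartesianProduct L (z ∷ L))
      ≡⟨ cong₂ _+_ z≮z (count-++ ordered? (map (z ,_) L) _) ⟩
    count ordered? (map (z ,_) L) + count ordered? (cartesianProduct L (z ∷ L))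
      ≡⟨ cong (count ordered? (map (z ,_) L) +_) (count-cartesianProduct-∷ʳ ordered? L z L) ⟩
    count ordered? (map (z ,_) L) + (count ordered? (map (_, z) L) + count ordered? (cartesianProduct L L))
      ≡⟨ +-assoc (count ordered? (map (z ,_) L)) _ _ ⟨
    count ordered? (map (z ,_) L) + count ordered? (map (_, z) L) + count ordered? (cartesianProduct L L)
      ≡⟨ cong₂ _+_ (count-ordered-row+column z L z∉L) (count-ordered-pairs L L!) ⟩
    length L + length L C 2
      ≡⟨ cong (_+ length L C 2) (nC1≡n (length L)) ⟨
    length L C 1 + length L C 2
      ≡⟨ nCk+nC[k+1]≡[n+1]C[k+1] (length L) 1 ⟩
    suc (length L) C 2 ∎
    where
    open ≡-Reasoning
    [z<z] : ℕ
    [z<z] = indicator (toℕ z <? toℕ z)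
    z≮z : indicator (toℕ z <? toℕ z) ≡ 0
    z≮z = indicator-no (toℕ z <? toℕ z) (<-irrefl refl)

module _ {n : ℕ} {G : Graph n} {P : Fin n → Fin n → Set} where

  _++ʷ_ : ∀ {u v w} → Walk G P u v → Walk G P v w → Walk G P u w
  here _       ++ʷ q = q
  step e p w   ++ʷ q = step e p (w ++ʷ q)

  reverseʷ : (∀ i j → adj G i j ≡ true → P i j → P j i) → ∀ {u v} → Walk G P u v → Walk G P v u
  reverseʷ P-sym (here u) = here u
  reverseʷ P-sym (step {u} {w} e p ws) = reverseʷ P-sym ws ++ʷ step (trans (Graph.sym G w u) e) (P-sym u w e p) (here u)

  open DecMembership (_≟_ {n}) using (_∈?_)

  suffix : ∀ {x v u} (w : Walk G P x v) → Unique (walkVertices w) → u ∈ walkVertices w → Path G P u v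
  suffix (here x)     w! (here refl) = here x , w!
  suffix (step e p w) w! (here refl) = step e p w , w!
  suffix (step e p w) (_ ∷ w!) (there u∈w) = suffix w w! u∈w

  walk⇒path : ∀ {u v} → Walk G P u v → Path G P u v
  walk⇒path (here u) = here u , [] ∷ []
  walk⇒path (step {u} e p w) with walk⇒path w
  ... | w′ , w′! with u ∈? walkVertices w′
  ...   | yes u∈w′ = suffix w′ w′! u∈w′
  ...   | no  u∉w′ = step e p w′ , ¬Any⇒All¬ _ u∉w′ ∷ w′!

  walk-invariant : ∀ {B : Set} (f : Fin n → B) → (∀ x y → adj G x y ≡ true → f x ≡ f y) →
                   ∀ {u v} → Walk G P u v → f u ≡ f v
  walk-invariant f f-adj (here _)     = refl
  walk-invariant f f-adj (step e _ w) = trans (f-adj _ _ e) (walk-invariant f f-adj w)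

module _ {n : ℕ} where

  sort : Fin n → Fin n → Fin n × Fin n
  sort x y with toℕ x <? toℕ y
  ... | yes _ = x , y
  ... | no  _ = y , x

  sort-comm : ∀ x y → sort x y ≡ sort y x
  sort-comm x y with toℕ x <? toℕ y | toℕ y <? toℕ x
  ... | yes x<y | yes y<x = contradiction y<x (<-asym x<y)
  ... | yes _   | no  _   = refl
  ... | no  _   | yes _   = refl
  ... | no  x≮y | no  y≮x with toℕ-injective (≤-antisym (≮⇒≥ y≮x) (≮⇒≥ x≮y))
  ...   | refl = refl

  sort-< : ∀ {x y} → toℕ x < toℕ y → sort x y ≡ (x , y)
  sort-< {x} {y} x<y with toℕ x <? toℕ y
  ... | yes _   = refl
  ... | no  x≮y = contradiction x<y x≮y

  sort-cases : ∀ x y → sort x y ≡ (x , y) ⊎ sort x y ≡ (y , x)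
  sort-cases x y with toℕ x <? toℕ y
  ... | yes _ = inj₁ refl
  ... | no  _ = inj₂ refl

  sort-ordered : ∀ {x y} → x ≢ y → toℕ (proj₁ (sort x y)) < toℕ (proj₂ (sort x y))
  sort-ordered {x} {y} x≢y with toℕ x <? toℕ y
  ... | yes x<y = x<y
  ... | no  x≮y with toℕ y <? toℕ x
  ...   | yes y<x = y<x
  ...   | no  y≮x = contradiction (toℕ-injective (≤-antisym (≮⇒≥ y≮x) (≮⇒≥ x≮y))) x≢y

  sort-injective : ∀ {x y u v} → sort x y ≡ sort u v → (x ≡ u × y ≡ v) ⊎ (x ≡ v × y ≡ u)
  sort-injective {x} {y} {u} {v} eq with sort-cases x y | sort-cases u v
  ... | inj₁ xy | inj₁ uv = inj₁ (×-≡,≡←≡ (trans (sym xy) (trans eq uv)))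
  ... | inj₁ xy | inj₂ vu = inj₂ (×-≡,≡←≡ (trans (sym xy) (trans eq vu)))
  ... | inj₂ yx | inj₁ uv = inj₂ (swap (×-≡,≡←≡ (trans (sym yx) (trans eq uv))))
  ... | inj₂ yx | inj₂ vu = inj₁ (swap (×-≡,≡←≡ (trans (sym yx) (trans eq vu))))

  ownColor : Fin n → Fin n → ℕ
  ownColor x y = toℕ (combine (proj₁ (sort x y)) (proj₂ (sort x y)))

  ownColor-comm : ∀ x y → ownColor x y ≡ ownColor y x
  ownColor-comm x y = cong (λ e → toℕ (combine (proj₁ e) (proj₂ e))) (sort-comm x y)

  ownColor-injective : ∀ {i j k l : Fin n} → toℕ i < toℕ j → toℕ k < toℕ l →
                        ownColor i j ≡ ownColor k l → (i , j) ≡ (k , l)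
  ownColor-injective {i} {j} {k} {l} i<j k<l eq
    rewrite sort-< i<j | sort-< k<l = ×-≡,≡→≡ (combine-injective i j k l (toℕ-injective eq))

module _ {n : ℕ} (G : Graph n) where

  adj-irreflexive : ∀ {x y} → adj G x y ≡ true → x ≢ y
  adj-irreflexive {x} xy refl = contradiction (trans (sym xy) (Graph.irrefl G x)) λ ()

  adj? : Decidable (λ (e : Fin n × Fin n) → T (adj G (proj₁ e) (proj₂ e)))
  adj? e = T? (adj G (proj₁ e) (proj₂ e))

  edges-Unique : Unique (edges G)
  edges-Unique = filter⁺ (λ e → ordered? e ×-dec adj? e) (cartesianProduct⁺ (allFin⁺ n) (allFin⁺ n))

  ∈-edges⁻ : ∀ {e} → e ∈ edges G → toℕ (proj₁ e) < toℕ (proj₂ e) × adj G (proj₁ e) (proj₂ e) ≡ true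
  ∈-edges⁻ e∈ with ∈-filter⁻ (λ e → ordered? e ×-dec adj? e) {xs = cartesianProduct (allFin n) (allFin n)} e∈
  ... | _ , e< , T-adj = e< , Equivalence.to T-≡ T-adj

  sort∈edges : ∀ {x y} → adj G x y ≡ true → sort x y ∈ edges G
  sort∈edges {x} {y} xy = ∈-filter⁺ (λ e → ordered? e ×-dec adj? e)
    (∈-cartesianProduct⁺ (∈-allFin _) (∈-allFin _))
    (sort-ordered (adj-irreflexive xy) , Equivalence.from T-≡ (adj-sort (sort-cases x y)))
    where
    adj-sort : sort x y ≡ (x , y) ⊎ sort x y ≡ (y , x) → adj G (proj₁ (sort x y)) (proj₂ (sort x y)) ≡ true
    adj-sort (inj₁ xy-sorted) rewrite xy-sorted = xy
    adj-sort (inj₂ yx-sorted) rewrite yx-sorted = trans (Graph.sym G y x) xy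

module _ {n : ℕ} where

  nonAdj : Graph n → Fin n → Fin n → Bool
  nonAdj G x y with x ≟ y
  ... | yes _ = false
  ... | no  _ = not (adj G x y)

  complement : Graph n → Graph n
  complement G = record { adj = nonAdj G ; sym = nonAdj-sym ; irrefl = nonAdj-irrefl }
    where
    nonAdj-sym : ∀ x y → nonAdj G x y ≡ nonAdj G y x
    nonAdj-sym x y with x ≟ y | y ≟ x
    ... | yes _   | yes _   = refl
    ... | yes x≡y | no  y≢x = contradiction (sym x≡y) y≢x
    ... | no  x≢y | yes y≡x = contradiction (sym y≡x) x≢y
    ... | no  _   | no  _   = cong not (Graph.sym G x y)
    nonAdj-irrefl : ∀ x → nonAdj G x x ≡ false
    nonAdj-irrefl x with x ≟ x
    ... | yes _   = refl
    ... | no  x≢x = contradiction refl x≢x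

  module _ (G : Graph n) where

    complement-adj : ∀ {x y} → x ≢ y → adj G x y ≡ false → adj (complement G) x y ≡ true
    complement-adj {x} {y} x≢y ¬xy with x ≟ y
    ... | yes x≡y = contradiction x≡y x≢y
    ... | no  _   rewrite ¬xy = refl

    adj-or-complement : ∀ {x y} → x ≢ y → adj (complement G) x y ≡ false → adj G x y ≡ true
    adj-or-complement {x} {y} x≢y ¬x-y with x ≟ y
    ... | yes x≡y = contradiction x≡y x≢y
    ... | no  _ with adj G x y
    ...   | true  = refl
    ...   | false = contradiction ¬x-y λ ()

    numEdges+numEdges-complement : numEdges G + numEdges (complement G) ≡ n C 2
    numEdges+numEdges-complement = begin
      numEdges G + numEdges (complement G)
        ≡⟨ count-split ordered? (adj? G) (adj? (complement G)) complement⇒¬adj ¬adj⇒complement pairs ⟩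
      count ordered? pairs
        ≡⟨ count-ordered-pairs (allFin n) (allFin⁺ n) ⟩
      length (allFin n) C 2
        ≡⟨ cong (_C 2) (length-tabulate {n = n} id) ⟩
      n C 2 ∎
      where
      open ≡-Reasoning
      pairs : List (Fin n × Fin n)
      pairs = cartesianProduct (allFin n) (allFin n)
      complement⇒¬adj : ∀ {e} → T (nonAdj G (proj₁ e) (proj₂ e)) → ¬ T (adj G (proj₁ e) (proj₂ e))
      complement⇒¬adj {x , y} with x ≟ y
      ... | yes _ = λ ()
      ... | no  _ with adj G x y
      ...   | true  = λ ()
      ...   | false = λ _ ()
      ¬adj⇒complement : ∀ {e} → toℕ (proj₁ e) < toℕ (proj₂ e) → ¬ T (adj G (proj₁ e) (proj₂ e)) →
                        T (nonAdj G (proj₁ e) (proj₂ e))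
      ¬adj⇒complement {x , y} x<y ¬xy with x ≟ y
      ... | yes refl = <-irrefl refl x<y
      ... | no  _ with adj G x y
      ...   | true  = ¬xy _
      ...   | false = _

module _ {n : ℕ} {G : Graph n} (c : EdgeColoring G) where

  Owned : Fin n × Fin n → Set
  Owned (i , j) = col c i j ≡ ownColor i j

  owned? : Decidable Owned
  owned? (i , j) = col c i j ℕ.≟ ownColor i j

  unowned : List (Fin n × Fin n)
  unowned = filter (¬? ∘ owned?) (edges G)

  unowned-Unique : Unique unowned
  unowned-Unique = filter⁺ (¬? ∘ owned?) (edges-Unique G)

  ∈-unowned⁻ : ∀ {e} → e ∈ unowned → e ∈ edges G × ¬ Owned e
  ∈-unowned⁻ = ∈-filter⁻ (¬? ∘ owned?)

  count-owned≤numColors : count owned? (edges G) ≤ numColors c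
  count-owned≤numColors = length-≤-injectiveOn ℕ._≟_ (λ e → ownColor (proj₁ e) (proj₂ e))
    (filter⁺ owned? (edges-Unique G)) color∈ injective
    where
    colorOf : Fin n × Fin n → ℕ
    colorOf e = col c (proj₁ e) (proj₂ e)
    color∈ : ∀ {e} → e ∈ filter owned? (edges G) →
              ownColor (proj₁ e) (proj₂ e) ∈ deduplicate ℕ._≟_ (map colorOf (edges G))
    color∈ e∈ with ∈-filter⁻ owned? e∈
    ... | e∈edges , owned =
      ∈-deduplicate⁺ ℕ._≟_ (subst (_∈ map colorOf (edges G)) owned (∈-map⁺ colorOf e∈edges))
    injective : ∀ {e e′} → e ∈ filter owned? (edges G) → e′ ∈ filter owned? (edges G) →
                ownColor (proj₁ e) (proj₂ e) ≡ ownColor (proj₁ e′) (proj₂ e′) → e ≡ e′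
    injective e∈ e′∈ = ownColor-injective (proj₁ (∈-edges⁻ G (proj₁ (∈-filter⁻ owned? e∈))))
                                           (proj₁ (∈-edges⁻ G (proj₁ (∈-filter⁻ owned? e′∈))))

  numEdges≤numColors+unowned : numEdges G ≤ numColors c + length unowned
  numEdges≤numColors+unowned = begin
    numEdges G                                   ≡⟨ count+count-∁≡length owned? (edges G) ⟨
    count owned? (edges G) + length unowned      ≤⟨ +-monoˡ-≤ (length unowned) count-owned≤numColors ⟩
    numColors c + length unowned                 ∎
    where open ≤-Reasoning

module _ {A : Set} {u v : A → ℕ} (u≤v : ∀ x → u x ≤ v x) where

  sum-map-mono-≤ : ∀ xs → sum (map u xs) ≤ sum (map v xs)
  sum-map-mono-≤ []       = z≤n
  sum-map-mono-≤ (x ∷ xs) = +-mono-≤ (u≤v x) (sum-map-mono-≤ xs)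

  sum-map-mono-< : ∀ {x xs} → x ∈ xs → u x < v x → sum (map u xs) < sum (map v xs)
  sum-map-mono-< {xs = _ ∷ xs} (here refl) ux<vx = +-mono-<-≤ ux<vx (sum-map-mono-≤ xs)
  sum-map-mono-< {xs = y ∷ _} (there x∈xs) ux<vx = +-mono-≤-< (u≤v y) (sum-map-mono-< x∈xs ux<vx)

module SpanningForest {n : ℕ} (G : Graph n) where

  -- Since the
  -- weight step n + 1 exceeds every path length, label x = weight r + dist x r for the least vertex r of the
  -- component of x, which becomes the root of the tree of x.
  weight : Fin n → ℕ
  weight x = toℕ x * suc n

  relaxOver : (Fin n → ℕ) → Fin n → List (Fin n) → ℕ
  relaxOver v x []       = weight x
  relaxOver v x (y ∷ ys) = if adj G x y then suc (v y) ⊓ relaxOver v x ys else relaxOver v x ys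

  relax : (Fin n → ℕ) → Fin n → ℕ
  relax v x = relaxOver v x (allFin n)

  relaxOver-≤-weight : ∀ v x ys → relaxOver v x ys ≤ weight x
  relaxOver-≤-weight v x [] = ≤-refl
  relaxOver-≤-weight v x (y ∷ ys) with adj G x y
  ... | true  = m≤n⇒o⊓m≤n (suc (v y)) (relaxOver-≤-weight v x ys)
  ... | false = relaxOver-≤-weight v x ys

  relaxOver-≤-neighbor : ∀ v x {y} ys → y ∈ ys → adj G x y ≡ true → relaxOver v x ys ≤ suc (v y)
  relaxOver-≤-neighbor v x (y ∷ ys) (here refl) xy rewrite xy = m⊓n≤m _ _
  relaxOver-≤-neighbor v x (z ∷ ys) (there y∈ys) xy with adj G x z
  ... | true  = m≤n⇒o⊓m≤n (suc (v z)) (relaxOver-≤-neighbor v x ys y∈ys xy)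
  ... | false = relaxOver-≤-neighbor v x ys y∈ys xy

  relaxOver-attained : ∀ v x ys → relaxOver v x ys ≡ weight x ⊎
                       ∃[ y ] (adj G x y ≡ true × relaxOver v x ys ≡ suc (v y))
  relaxOver-attained v x [] = inj₁ refl
  relaxOver-attained v x (y ∷ ys) with adj G x y in xy
  ... | false = relaxOver-attained v x ys
  ... | true with ⊓-sel (suc (v y)) (relaxOver v x ys)
  ...   | inj₁ ≡y = inj₂ (y , xy , ≡y)
  ...   | inj₂ ≡rest with relaxOver-attained v x ys
  ...     | inj₁ ≡w            = inj₁ (trans ≡rest ≡w)
  ...     | inj₂ (z , xz , ≡z) = inj₂ (z , xz , trans ≡rest ≡z)

  relaxOver-mono : ∀ {u v} x ys → (∀ y → u y ≤ v y) → relaxOver u x ys ≤ relaxOver v x ys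
  relaxOver-mono x [] u≤v = ≤-refl
  relaxOver-mono x (y ∷ ys) u≤v with adj G x y
  ... | true  = ⊓-mono-≤ (s≤s (u≤v y)) (relaxOver-mono x ys u≤v)
  ... | false = relaxOver-mono x ys u≤v

  total : (Fin n → ℕ) → ℕ
  total v = sum (map v (allFin n))

  iterate : ℕ → (Fin n → ℕ) → Fin n → ℕ
  iterate zero    v = v
  iterate (suc k) v with all? (λ x → relax v x ℕ.≟ v x)
  ... | yes _ = v
  ... | no  _ = iterate k (relax v)

  -- Each round that does not reach a fixed point strictly decreases the total.
  iterate-fixed : ∀ k v → (∀ x → relax v x ≤ v x) → total v < k →
                  ∀ x → relax (iterate k v) x ≡ iterate k v x
  iterate-fixed (suc k) v relax≤ total<k with all? (λ x → relax v x ℕ.≟ v x)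
  ... | yes fixed = fixed
  ... | no ¬fixed = iterate-fixed k (relax v) (λ x → relaxOver-mono x (allFin n) relax≤) total′<k
    where
    moved : ∃[ x ] (relax v x ≢ v x)
    moved = ¬∀⟶∃¬ n _ (λ x → relax v x ℕ.≟ v x) ¬fixed
    total′<k : total (relax v) < k
    total′<k = ≤-trans (sum-map-mono-< relax≤ (∈-allFin (proj₁ moved))
                          (≤∧≢⇒< (relax≤ (proj₁ moved)) (proj₂ moved)))
                       (≤-pred total<k)

  opaque
    label : Fin n → ℕ
    label = iterate (suc (total weight)) weight

    relax-label : ∀ x → relax label x ≡ label x
    relax-label = iterate-fixed (suc (total weight)) weight (λ x → relaxOver-≤-weight weight x (allFin n)) ≤-refl

  label-≤-weight : ∀ x → label x ≤ weight x
  label-≤-weight x = subst (_≤ weight x) (relax-label x) (relaxOver-≤-weight label x (allFin n))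

  label-≤-neighbor : ∀ x y → adj G x y ≡ true → label x ≤ suc (label y)
  label-≤-neighbor x y xy =
    subst (_≤ suc (label y)) (relax-label x) (relaxOver-≤-neighbor label x (allFin n) (∈-allFin y) xy)

  label-attained : ∀ x → label x ≡ weight x ⊎ ∃[ y ] (adj G x y ≡ true × label x ≡ suc (label y))
  label-attained x with relaxOver-attained label x (allFin n)
  ... | inj₁ ≡w            = inj₁ (trans (sym (relax-label x)) ≡w)
  ... | inj₂ (y , xy , ≡y) = inj₂ (y , xy , trans (sym (relax-label x)) ≡y)

  Root : Fin n → Set
  Root x = label x ≡ weight x

  root? : ∀ x → Dec (Root x)
  root? x = label x ℕ.≟ weight x

  opaque
    parent-spec : ∀ x → ∃[ y ] ((¬ Root x → adj G x y ≡ true × label x ≡ suc (label y)) × (Root x → y ≡ x))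
    parent-spec x with root? x
    ... | yes x-root = x , (λ ¬x-root → contradiction x-root ¬x-root) , (λ _ → refl)
    ... | no ¬x-root with label-attained x
    ...   | inj₁ x-root          = contradiction x-root ¬x-root
    ...   | inj₂ (y , xy , ≡y)   = y , (λ _ → xy , ≡y) , (λ x-root → contradiction x-root ¬x-root)

  parent : Fin n → Fin n
  parent x = proj₁ (parent-spec x)

  parent-adj : ∀ x → ¬ Root x → adj G x (parent x) ≡ true
  parent-adj x ¬x-root = proj₁ (proj₁ (proj₂ (parent-spec x)) ¬x-root)

  label-parent : ∀ x → ¬ Root x → label x ≡ suc (label (parent x))
  label-parent x ¬x-root = proj₂ (proj₁ (proj₂ (parent-spec x)) ¬x-root)

  parent-Root : ∀ x → Root x → parent x ≡ x
  parent-Root x = proj₂ (proj₂ (parent-spec x))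

  parent-rec : (P : Fin n → Set) → (∀ x → Root x → P x) → (∀ x → ¬ Root x → P (parent x) → P x) →
               ∀ x → P x
  parent-rec P at-root at-child x = go (label x) x ≤-refl
    where
    go : ∀ k x → label x ≤ k → P x
    go k x label≤k with root? x
    go k       x label≤k | yes x-root  = at-root x x-root
    go zero    x label≤0 | no ¬x-root  = contradiction (trans (sym (n≤0⇒n≡0 label≤0)) (label-parent x ¬x-root)) λ ()
    go (suc k) x label≤k | no ¬x-root  =
      at-child x ¬x-root (go k (parent x) (s≤s⁻¹ (subst (_≤ suc k) (label-parent x ¬x-root) label≤k)))

  ascend : ℕ → Fin n → Fin n
  ascend zero    x = x
  ascend (suc k) x = ascend k (parent x)

  root : Fin n → Fin n
  root x = ascend (label x) x

  ascend-Root : ∀ k x → Root x → ascend k x ≡ x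
  ascend-Root zero    x x-root = refl
  ascend-Root (suc k) x x-root = trans (cong (ascend k) (parent-Root x x-root)) (ascend-Root k x x-root)

  root-of-Root : ∀ x → Root x → root x ≡ x
  root-of-Root x = ascend-Root (label x) x

  root-parent : ∀ x → root (parent x) ≡ root x
  root-parent x with root? x
  ... | yes x-root = cong root (parent-Root x x-root)
  ... | no ¬x-root = sym (cong (λ k → ascend k x) (label-parent x ¬x-root))

  root-Root : ∀ x → Root (root x)
  root-Root = parent-rec (λ x → Root (root x))
    (λ x x-root → subst Root (sym (root-of-Root x x-root)) x-root)
    (λ x _ → subst Root (root-parent x))

  label-root : ∀ x → label (root x) ≤ label x
  label-root = parent-rec (λ x → label (root x) ≤ label x)
    (λ x x-root → ≤-reflexive (cong label (root-of-Root x x-root)))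
    (λ x ¬x-root ih → begin
      label (root x)         ≡⟨ cong label (root-parent x) ⟨
      label (root (parent x)) ≤⟨ ih ⟩
      label (parent x)        ≤⟨ n≤1+n _ ⟩
      suc (label (parent x))  ≡⟨ label-parent x ¬x-root ⟨
      label x                 ∎)
    where open ≤-Reasoning

  path-to-root : ∀ x → ∃[ l ] (Unique l × All (λ y → label y ≤ label x) l ×
                               label x + 1 ≡ label (root x) + length l)
  path-to-root = parent-rec _
    (λ x x-root → x ∷ [] , [] ∷ [] , ≤-refl ∷ [] , cong (λ r → label r + 1) (sym (root-of-Root x x-root)))
    λ { x ¬x-root (l , l! , l≤ , len) →
        let label-x = label-parent x ¬x-root in
        x ∷ l
        , All.map (λ y≤ x≡y → 1+n≰n (subst (_≤ label (parent x)) (trans (cong label (sym x≡y)) label-x) y≤)) l≤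
          ∷ l!
        , ≤-refl ∷ All.map (λ y≤ → ≤-trans y≤ (≤-trans (n≤1+n _) (≤-reflexive (sym label-x)))) l≤
        , (begin
            label x + 1                          ≡⟨ cong (_+ 1) label-x ⟩
            suc (label (parent x) + 1)           ≡⟨ cong suc len ⟩
            suc (label (root (parent x)) + length l) ≡⟨ +-suc _ _ ⟨
            label (root (parent x)) + suc (length l) ≡⟨ cong (λ r → label r + suc (length l)) (root-parent x) ⟩
            label (root x) + suc (length l)       ∎) }
    where open ≡-Reasoning

  label-≤-depth : ∀ x → label x + 1 ≤ label (root x) + n
  label-≤-depth x with path-to-root x
  ... | l , l! , _ , len = begin
    label x + 1             ≡⟨ len ⟩
    label (root x) + length l ≤⟨ +-monoʳ-≤ (label (root x)) (Unique-⊆⇒length≤ _≟_ l! (λ _ → ∈-allFin _)) ⟩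
    label (root x) + length (allFin n) ≡⟨ cong (label (root x) +_) (length-tabulate id) ⟩
    label (root x) + n      ∎
    where open ≤-Reasoning

  -- Labels of neighbors differ by at most one, while the labels of different trees lie in disjoint blocks.
  root-≤-neighbor : ∀ x y → label y ≤ suc (label x) → toℕ (root y) ≤ toℕ (root x)
  root-≤-neighbor x y label-y≤ = ≮⇒≥ λ rx<ry → <-irrefl refl (begin-strict
    weight (root x) + n        <⟨ +-monoʳ-< (weight (root x)) (n<1+n n) ⟩
    weight (root x) + suc n    ≡⟨ +-comm (weight (root x)) (suc n) ⟩
    suc (toℕ (root x)) * suc n ≤⟨ *-monoˡ-≤ (suc n) rx<ry ⟩
    weight (root y)            ≡⟨ root-Root y ⟨
    label (root y)             ≤⟨ label-root y ⟩
    label y                    ≤⟨ label-y≤ ⟩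
    suc (label x)              ≡⟨ +-comm 1 (label x) ⟩
    label x + 1                ≤⟨ label-≤-depth x ⟩
    label (root x) + n         ≡⟨ cong (_+ n) (root-Root x) ⟩
    weight (root x) + n        ∎)
    where open ≤-Reasoning

  root-adj : ∀ x y → adj G x y ≡ true → root x ≡ root y
  root-adj x y xy = toℕ-injective (≤-antisym
    (root-≤-neighbor y x (label-≤-neighbor x y xy))
    (root-≤-neighbor x y (label-≤-neighbor y x (trans (Graph.sym G y x) xy))))

  Root-toℕ≡0 : ∀ x → toℕ x ≡ 0 → Root x
  Root-toℕ≡0 x x≡0 = ≤-antisym (label-≤-weight x) (subst (λ k → k * suc n ≤ label x) (sym x≡0) z≤n)

  parent-no-2-cycle : ∀ x y → ¬ Root x → ¬ Root y → x ≡ parent y → y ≡ parent x → ⊥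
  parent-no-2-cycle x y ¬x-root ¬y-root x≡py y≡px =
    <-asym (subst (λ z → label z < label x) (sym y≡px) (≤-reflexive (sym (label-parent x ¬x-root))))
           (subst (λ z → label z < label y) (sym x≡py) (≤-reflexive (sym (label-parent y ¬y-root))))

  nonRoots : List (Fin n)
  nonRoots = filter (¬? ∘ root?) (allFin n)

  nonRoots-Unique : Unique nonRoots
  nonRoots-Unique = filter⁺ (¬? ∘ root?) (allFin⁺ n)

  ∈-nonRoots⁺ : ∀ {x} → ¬ Root x → x ∈ nonRoots
  ∈-nonRoots⁺ {x} = ∈-filter⁺ (¬? ∘ root?) (∈-allFin x)

  ∈-nonRoots⁻ : ∀ {x} → x ∈ nonRoots → ¬ Root x
  ∈-nonRoots⁻ x∈ = proj₂ (∈-filter⁻ (¬? ∘ root?) {xs = allFin n} x∈)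

  length-nonRoots≤numEdges : length nonRoots ≤ numEdges G
  length-nonRoots≤numEdges = length-≤-injectiveOn (≡-dec _≟_ _≟_) (λ x → sort x (parent x)) nonRoots-Unique
    (λ x∈ → sort∈edges G (parent-adj _ (∈-nonRoots⁻ x∈))) injective
    where
    injective : ∀ {x y} → x ∈ nonRoots → y ∈ nonRoots → sort x (parent x) ≡ sort y (parent y) → x ≡ y
    injective {x} {y} x∈ y∈ eq with sort-injective eq
    ... | inj₁ (x≡y , _)     = x≡y
    ... | inj₂ (x≡py , px≡y) =
      ⊥-elim (parent-no-2-cycle x y (∈-nonRoots⁻ x∈) (∈-nonRoots⁻ y∈) x≡py (sym px≡y))

module _ {n : ℕ} (G : Graph n) where

  open SpanningForest G

  TreeEdge : Fin n → Fin n → Set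
  TreeEdge i j = (¬ Root j × parent j ≡ i) ⊎ (¬ Root i × parent i ≡ j)

  treeEdge? : ∀ i j → Dec (TreeEdge i j)
  treeEdge? i j = (¬? (root? j) ×-dec (parent j ≟ i)) ⊎-dec (¬? (root? i) ×-dec (parent i ≟ j))

  treeColor : Fin n → Fin n → ℕ
  treeColor i j with treeEdge? i j
  ... | yes _ = 0
  ... | no  _ = ownColor i j

  treeColor-comm : ∀ i j → treeColor i j ≡ treeColor j i
  treeColor-comm i j with treeEdge? i j | treeEdge? j i
  ... | yes _  | yes _  = refl
  ... | yes ij | no ¬ji = contradiction (Sum.swap ij) ¬ji
  ... | no ¬ij | yes ji = contradiction (Sum.swap ji) ¬ij
  ... | no  _  | no  _  = ownColor-comm i j

  treeColoring : EdgeColoring G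
  treeColoring = record { col = treeColor ; colSym = λ i j _ → treeColor-comm i j }

  treeColor-parent : ∀ x → ¬ Root x → treeColor x (parent x) ≡ 0
  treeColor-parent x ¬x-root with treeEdge? x (parent x)
  ... | yes _   = refl
  ... | no ¬xpx = contradiction (inj₂ (¬x-root , refl)) ¬xpx

  ZeroColored : Fin n → Fin n → Set
  ZeroColored i j = treeColor i j ≡ 0

  walk-to-root : ∀ x → Walk G ZeroColored x (root x)
  walk-to-root = parent-rec (λ x → Walk G ZeroColored x (root x))
    (λ x x-root → subst (Walk G ZeroColored x) (sym (root-of-Root x x-root)) (here x))
    (λ x ¬x-root w → step (parent-adj x ¬x-root) (treeColor-parent x ¬x-root)
                          (subst (Walk G ZeroColored (parent x)) (root-parent x) w))

  treeColoring-IsMC : Connected G → IsMC treeColoring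
  treeColoring-IsMC connected u v = 0 , walk⇒path (walk-to-root u ++ʷ subst (λ r → Walk G ZeroColored r v) rv≡ru
                                                    (reverseʷ (λ i j _ → trans (treeColor-comm j i)) (walk-to-root v)))
    where
    rv≡ru : root v ≡ root u
    rv≡ru = walk-invariant root root-adj (proj₁ (connected v u))

  length-unowned-treeColoring : length (unowned treeColoring) ≤ length nonRoots
  length-unowned-treeColoring =
    length-≤-cover (≡-dec _≟_ _≟_) (λ x → sort x (parent x)) (unowned-Unique treeColoring) parent-edge
    where
    parent-edge : ∀ {e} → e ∈ unowned treeColoring → ∃[ x ] (x ∈ nonRoots × e ≡ sort x (parent x))
    parent-edge {i , j} e∈ with ∈-unowned⁻ treeColoring e∈
    ... | e∈edges , ¬owned with treeEdge? i j | proj₁ (∈-edges⁻ G e∈edges)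
    ...   | no _                        | _   = contradiction refl ¬owned
    ...   | yes (inj₁ (¬j-root , refl)) | i<j = j , ∈-nonRoots⁺ ¬j-root , sym (trans (sort-comm j i) (sort-< i<j))
    ...   | yes (inj₂ (¬i-root , refl)) | i<j = i , ∈-nonRoots⁺ ¬i-root , sym (sort-< i<j)

module HubColoring {n : ℕ} (G : Graph n) {a b : Fin n} (a-root : SpanningForest.Root (complement G) a)
                    (b-root : SpanningForest.Root (complement G) b) (a≢b : a ≢ b) where

  open SpanningForest (complement G)

  center : Fin n → Fin n
  center r with r ≟ a
  ... | yes _ = b
  ... | no  _ = a

  hub : Fin n → Fin n
  hub x = center (root x)

  hub-Root : ∀ x → Root (hub x)
  hub-Root x with root x ≟ a
  ... | yes _ = b-root
  ... | no  _ = a-root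

  root-hub : ∀ x → root (hub x) ≢ root x
  root-hub x with root x ≟ a
  ... | yes rx≡a = λ b≡rx → a≢b (trans (sym rx≡a) (trans (sym b≡rx) (root-of-Root b b-root)))
  ... | no  rx≢a = λ a≡rx → rx≢a (trans (sym a≡rx) (root-of-Root a a-root))

  adj-hub : ∀ x → adj G x (hub x) ≡ true
  adj-hub x with adj (complement G) x (hub x) in x-hub
  ... | true  = contradiction (sym (root-adj x (hub x) x-hub)) (root-hub x)
  ... | false = adj-or-complement G (λ x≡hub → root-hub x (cong root (sym x≡hub))) x-hub

  -- Depends on x only through its component, so that all edges to a common hub share their color.
  hubColorOf : Fin n → ℕ
  hubColorOf x = ownColor (root x) (root (hub x))

  hubColor : Fin n → Fin n → ℕ
  hubColor i j with j ≟ hub i | i ≟ hub j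
  ... | yes _ | _     = hubColorOf i
  ... | no  _ | yes _ = hubColorOf j
  ... | no  _ | no  _ = ownColor i j

  hubColor-comm : ∀ i j → hubColor i j ≡ hubColor j i
  hubColor-comm i j with j ≟ hub i | i ≟ hub j
  ... | yes j≡hi | yes i≡hj = begin
    ownColor (root i) (root (hub i))  ≡⟨ cong (λ z → ownColor (root i) (root z)) j≡hi ⟨
    ownColor (root i) (root j)        ≡⟨ ownColor-comm (root i) (root j) ⟩
    ownColor (root j) (root i)        ≡⟨ cong (λ z → ownColor (root j) (root z)) i≡hj ⟩
    ownColor (root j) (root (hub j))  ∎
    where open ≡-Reasoning
  ... | yes _    | no  _    = refl
  ... | no  _    | yes _    = refl
  ... | no  _    | no  _    = ownColor-comm i j

  hubColor-hub : ∀ x → hubColor x (hub x) ≡ hubColorOf x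
  hubColor-hub x with hub x ≟ hub x
  ... | yes _ = refl
  ... | no  h≢h = contradiction refl h≢h

  hubColoring : EdgeColoring G
  hubColoring = record { col = hubColor ; colSym = λ i j _ → hubColor-comm i j }

  hubColoring-IsMC : IsMC hubColoring
  hubColoring-IsMC u v with u ≟ v
  ... | yes refl = 0 , walk⇒path (here u)
  ... | no u≢v with adj G u v in uv
  ...   | true  = hubColor u v , walk⇒path (step uv refl (here v))
  ...   | false = hubColorOf u , walk⇒path (step (adj-hub u) (hubColor-hub u) (step hub-v v-color (here v)))
    where
    same-root : root u ≡ root v
    same-root = root-adj u v (complement-adj G u≢v uv)
    same-hub : hub v ≡ hub u
    same-hub = cong center (sym same-root)
    hub-v : adj G (hub u) v ≡ true
    hub-v = trans (Graph.sym G (hub u) v) (subst (λ h → adj G v h ≡ true) same-hub (adj-hub v))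
    v-color : hubColor (hub u) v ≡ hubColorOf u
    v-color = begin
      hubColor (hub u) v  ≡⟨ hubColor-comm (hub u) v ⟩
      hubColor v (hub u)  ≡⟨ cong (hubColor v) same-hub ⟨
      hubColor v (hub v)  ≡⟨ hubColor-hub v ⟩
      hubColorOf v        ≡⟨ cong (λ r → ownColor r (root (center r))) same-root ⟨
      hubColorOf u        ∎
      where open ≡-Reasoning

  hubColorOf-Root : ∀ x → Root x → hubColorOf x ≡ ownColor x (hub x)
  hubColorOf-Root x x-root = cong₂ ownColor (root-of-Root x x-root) (root-of-Root (hub x) (hub-Root x))

  length-unowned-hubColoring : length (unowned hubColoring) ≤ length nonRoots
  length-unowned-hubColoring =
    length-≤-cover (≡-dec _≟_ _≟_) (λ x → sort x (hub x)) (unowned-Unique hubColoring) hub-edge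
    where
    hub-edge : ∀ {e} → e ∈ unowned hubColoring → ∃[ x ] (x ∈ nonRoots × e ≡ sort x (hub x))
    hub-edge {i , j} e∈ with ∈-unowned⁻ hubColoring e∈
    ... | e∈edges , ¬owned with j ≟ hub i | i ≟ hub j | proj₁ (∈-edges⁻ G e∈edges)
    ...   | yes refl | _        | i<j = i , ∈-nonRoots⁺ (λ i-root → ¬owned (hubColorOf-Root i i-root)) , sym (sort-< i<j)
    ...   | no  _    | yes refl | i<j = j , ∈-nonRoots⁺ (λ j-root → ¬owned (trans (hubColorOf-Root j j-root)
                                                                                   (ownColor-comm j i)))
                                        , sym (trans (sort-comm j i) (sort-< i<j))
    ...   | no  _    | no  _    | _   = contradiction refl ¬owned

module _ {m : ℕ} (G : Graph (suc m)) (connected : Connected G) where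

  private
    module T = SpanningForest G
    module F = SpanningForest (complement G)

  MC-coloring-with-few-unowned : Σ[ c ∈ EdgeColoring G ] (IsMC c × length (unowned c) ≤ length F.nonRoots)
  MC-coloring-with-few-unowned with all? (λ x → F.root x ≟ zero)
  ... | yes complement-connected =
    treeColoring G , treeColoring-IsMC G connected , ≤-trans (length-unowned-treeColoring G) T-nonRoots≤F-nonRoots
    where
    T-nonRoots≤F-nonRoots : length T.nonRoots ≤ length F.nonRoots
    T-nonRoots≤F-nonRoots = Unique-⊆⇒length≤ _≟_ T.nonRoots-Unique λ {x} x∈ → F.∈-nonRoots⁺ λ x-root →
      T.∈-nonRoots⁻ x∈ (subst T.Root (trans (sym (complement-connected x)) (F.root-of-Root x x-root))
                                     (T.Root-toℕ≡0 zero refl))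
  ... | no ¬complement-connected with ¬∀⟶∃¬ _ _ (λ x → F.root x ≟ zero) ¬complement-connected
  ...   | x , rx≢zero =
    hubColoring , hubColoring-IsMC , length-unowned-hubColoring
    where open HubColoring G (F.Root-toℕ≡0 zero refl) (F.root-Root x) (≢-sym rx≢zero)

mc-lower-bound : ∀ {n} (G : Graph n) → Connected G →
                 Σ[ c ∈ EdgeColoring G ] (IsMC c × numEdges G ≤ numColors c + numEdges (complement G))
mc-lower-bound {zero} G _ = record { col = λ _ _ → 0 ; colSym = λ _ _ _ → refl } , (λ ()) , z≤n
mc-lower-bound {suc m} G connected with MC-coloring-with-few-unowned G connected
... | c , c-MC , few-unowned = c , c-MC , (begin
  numEdges G                                ≤⟨ numEdges≤numColors+unowned c ⟩
  numColors c + length (unowned c)          ≤⟨ +-monoʳ-≤ (numColors c) few-unowned ⟩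
  numColors c + length F.nonRoots           ≤⟨ +-monoʳ-≤ (numColors c) F.length-nonRoots≤numEdges ⟩
  numColors c + numEdges (complement G)     ∎)
  where
  open ≤-Reasoning
  module F = SpanningForest (complement G)

numEdges-complement≤ : ∀ {n} (G : Graph n) p → n C 2 ∸ p ≤ numEdges G → numEdges (complement G) ≤ p
numEdges-complement≤ {n} G p many-edges = +-cancelˡ-≤ (numEdges G) _ _ (begin
  numEdges G + numEdges (complement G)  ≡⟨ numEdges+numEdges-complement G ⟩
  n C 2                                 ≤⟨ m≤n+m∸n (n C 2) p ⟩
  p + (n C 2 ∸ p)                       ≤⟨ +-monoʳ-≤ p many-edges ⟩
  p + numEdges G                        ≡⟨ +-comm p (numEdges G) ⟩
  numEdges G + p                        ∎)
  where open ≤-Reasoning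

corollary1 : (n p : ℕ) → 2 * p ≤ n C 2 →
    f≤ n (n C 2 ∸ 2 * p) (n C 2 ∸ p)
corollary1 n p _ = n C 2 ∸ p , ≤-refl , many-colors
  where
  many-colors : FProp n (n C 2 ∸ 2 * p) (n C 2 ∸ p)
  many-colors G connected many-edges with mc-lower-bound G connected
  ... | c , c-MC , colors-bound = c , c-MC , m≤n+o⇒m∸n≤o (n C 2) (2 * p) (begin
    n C 2                                        ≡⟨ numEdges+numEdges-complement G ⟨
    numEdges G + numEdges (complement G)         ≤⟨ +-mono-≤ colors-bound few-non-edges ⟩
    numColors c + numEdges (complement G) + p    ≤⟨ +-monoˡ-≤ p (+-monoʳ-≤ (numColors c) few-non-edges) ⟩
    numColors c + p + p                          ≡⟨ +-assoc (numColors c) p p ⟩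
    numColors c + (p + p)                        ≡⟨ cong (λ q → numColors c + (p + q)) (+-identityʳ p) ⟨
    numColors c + 2 * p                          ≡⟨ +-comm (numColors c) (2 * p) ⟩
    2 * p + numColors c                          ∎)
    where
    open ≤-Reasoning
    few-non-edges : numEdges (complement G) ≤ p
    few-non-edges = numEdges-complement≤ G p many-edges
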